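{- Let $e_1,\dots,e_u$ be positive integers and $k'=\sum_{i=1}^u e_i$. Let $V^{(1)},\dots,V^{(n)}$ be a $k'$-disperse sequence of clopen subsets of $2^\omega$. For $1\le i\le u$ let $\mathcal{K}_i=\{K\subseteq\{1,\dots,n\}: (V^{(j)})_{j\in K}\text{ is } e_i\text{ -disperse}\}$. Then $\vec{\mathcal{K}}=(\mathcal{K}_1,\dots,\mathcal{K}_u)$ is a $u$-supporter of $\{1,\dots,n\}$.
   Context: A sequence of clopen sets $V^{(1)},\dots,V^{(m)}$ (indexed by a finite index set $I$) is $u$-disperse iff for every ordered $u$-partition (not necessarily pairwise disjoint, parts may be empty) $P^{(1)}\cup\cdots\cup P^{(u)}=I$ there is $i\le u$ with $\bigcap_{j\in P^{(i)}}V^{(j)}=\emptyset$ (an empty intersection means $2^\omega$). A tuple $\vec{\mathcal{K}}=(\mathcal{K}_1,\dots,\mathcal{K}_u)$, where each $\mathcal{K}_i$ is a finite class of subsets of $\{1,\dots,n\}$, is a $u$-supporter of $\{1,\dots,n\}$ iff for every ordered $u$-partition (not necessarily pairwise disjoint) $P^{(1)}\cup\cdots\cup P^{(u)}=\{1,\dots,n\}$ there exist $i\le u$ and $K\in\mathcal{K}_i$ with $K\subseteq P^{(i)}$. -}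

module Defs where

open import Data.Nat using (ℕ; _+_; _<_)
open import Data.Bool using (Bool; true)
open import Data.Fin using (Fin; toℕ)
open import Data.Fin.Subset using (Subset; _∈_; _⊆_)
open import Data.Product using (∃; ∃-syntax; _×_)
open import Relation.Nullary using (¬_)
open import Relation.Binary.PropositionalEquality using (_≡_)
import Data.Vec.Functional as VF

Cantor : Set
Cantor = ℕ → Bool

-- A clopen subset of 2^ω: one determined by finitely many coordinates,
-- given by a depth d and a Boolean function on the first d bits.
record Clopen : Set where
  constructor clopen
  field
    depth : ℕ
    char  : (Fin depth → Bool) → Bool

_∈C_ : Cantor → Clopen → Set
x ∈C V = Clopen.char V (λ i → x (toℕ i)) ≡ true

-- The intersection ⋂_{j ∈ P} V^(j) is empty (empty P gives 2^ω, nonempty).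
EmptyInter : ∀ {n} → (Fin n → Clopen) → Subset n → Set
EmptyInter {n} V P = ∀ (x : Cantor) → ¬ (∀ (j : Fin n) → j ∈ P → x ∈C V j)

-- P^(1) ∪ ... ∪ P^(u) = I  (parts need not be disjoint, may be empty)
IsCover : ∀ {n u} → Subset n → (Fin u → Subset n) → Set
IsCover {n} {u} I P =
  (∀ (i : Fin u) → P i ⊆ I) × (∀ (j : Fin n) → j ∈ I → ∃[ i ] (j ∈ P i))

Disperse : ∀ {n} → (Fin n → Clopen) → Subset n → ℕ → Set
Disperse {n} V I u =
  ∀ (P : Fin u → Subset n) → IsCover I P → ∃[ i ] EmptyInter V (P i)

-- (𝒦_1,…,𝒦_u) is a u-supporter of {1,…,n}; classes of subsets of the
-- finite set Fin n are given as predicates (hence automatically finite).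
Supporter : ∀ (n u : ℕ) → (Fin u → Subset n → Set) → Set
Supporter n u 𝒦 =
  ∀ (P : Fin u → Subset n) → IsCover Data.Fin.Subset.⊤ P →
    ∃[ i ] ∃[ K ] (𝒦 i K × K ⊆ P i)

sumFin : ∀ {u} → (Fin u → ℕ) → ℕ
sumFin e = VF.foldr _+_ 0 e

module Submission where

-- Given a cover P(1) ∪ … ∪ P(u) of {1,…,n} we show that some
-- (V(j))_{j ∈ P(i)} is e_i-disperse, so K = P(i) witnesses the supporter
-- property.  Classically: otherwise every P(i) has a cover by e_i parts with
-- nonempty intersections, and concatenating these covers gives a cover of
-- {1,…,n} by k' = Σ e_i parts all with nonempty intersection, contradicting
-- k'-dispersity.  Constructively we cannot extract these bad covers from a
-- negation, so we argue positively:
--   * every choice q of candidate covers (q i of P(i)) is refuted at some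
--     index i: either q i does not cover P(i), or (by k'-dispersity of the
--     concatenation) one of its parts has empty intersection;
--   * candidate covers range over an exhaustible (finite) type, and for
--     exhaustible factors "every choice is refuted at some index" upgrades to
--     "some index refutes all its candidates", i.e. some P(i) is e_i-disperse.

open import Defs
open import Data.Nat using (ℕ; zero; suc; _<_)
open import Data.Fin using (Fin; zero; suc; splitAt; _↑ˡ_; _↑ʳ_)
open import Data.Fin.Subset using (Subset; ⊤; _∈_)
open import Data.Fin.Subset.Properties using (_∈?_; _⊆?_)
open import Data.Fin.Properties using (all?; any?; ¬∀⟶∃¬; splitAt-↑ˡ; splitAt-↑ʳ)
open import Data.Bool using (Bool; true; false)
open import Data.Vec using (Vec; []; _∷_; lookup; tabulate)
open import Data.Vec.Properties using (lookup∘tabulate)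
open import Data.Product using (Σ; ∃-syntax; _,_; proj₁; proj₂)
open import Data.Sum using (_⊎_; inj₁; inj₂; [_,_]′; map₁; map₂)
open import Data.Empty using (⊥; ⊥-elim)
open import Relation.Nullary using (Dec; yes; no)
open import Relation.Nullary.Decidable using (_×-dec_; _→-dec_)
open import Relation.Binary.PropositionalEquality using (_≡_; refl; sym; subst)

-- Finite types have this
-- property constructively; it replaces "pick a counterexample".
Exhaustible : Set → Set₁
Exhaustible T =
  ∀ (B : T → Set) (Y : Set) → (∀ t → B t ⊎ Y) → (∀ t → B t) ⊎ Y

exhaustible-Bool : Exhaustible Bool
exhaustible-Bool B Y h with h true | h false
... | inj₂ y  | _       = inj₂ y
... | inj₁ _  | inj₂ y  = inj₂ y
... | inj₁ bt | inj₁ bf = inj₁ λ { true → bt ; false → bf }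

-- Vectors over an exhaustible type are exhaustible: exhaust the tail for
-- each fixed head, then exhaust the head.
exhaustible-Vec : ∀ {T} → Exhaustible T → ∀ m → Exhaustible (Vec T m)
exhaustible-Vec ex zero B Y h = map₁ (λ b → λ { [] → b }) (h [])
exhaustible-Vec ex (suc m) B Y h =
  map₁ (λ f → λ { (a ∷ ts) → f a ts })
    (ex (λ a → ∀ ts → B (a ∷ ts)) Y
        (λ a → exhaustible-Vec ex m (λ ts → B (a ∷ ts)) Y (λ ts → h (a ∷ ts))))

exhaustible-Subset : ∀ {n} → Exhaustible (Subset n)
exhaustible-Subset {n} = exhaustible-Vec exhaustible-Bool n

-- The side condition R makes the induction on the number of factors go
-- through: for a fixed first coordinate t, the remaining factors are handled
-- with R ⊎ G zero t in place of R, and then t is exhausted.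
uniformFactor : ∀ u (T : Fin u → Set) → (∀ i → Exhaustible (T i)) →
                (G : ∀ i → T i → Set) (R : Set) →
                (∀ (q : ∀ i → T i) → R ⊎ ∃[ i ] G i (q i)) →
                R ⊎ ∃[ i ] (∀ t → G i t)
uniformFactor zero T ex G R h = map₂ (λ { (() , _) }) (h (λ ()))
uniformFactor (suc u) T ex G R h =
  [ (λ all₀ → inj₂ (zero , all₀)) , map₂ (λ { (i , g) → suc i , g }) ]′
    (ex zero (G zero) Rest fixedHead)
  where
  Rest : Set
  Rest = R ⊎ ∃[ i ] (∀ t → G (suc i) t)

  cons : T zero → (∀ i → T (suc i)) → ∀ i → T i
  cons t q zero    = t
  cons t q (suc i) = q i

  shift : ∀ {t q} → R ⊎ ∃[ i ] G i (cons t q i) →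
          (R ⊎ G zero t) ⊎ ∃[ i ] G (suc i) (q i)
  shift (inj₁ r)             = inj₁ (inj₁ r)
  shift (inj₂ (zero , g))    = inj₁ (inj₂ g)
  shift (inj₂ (suc i , g))   = inj₂ (i , g)

  regroup : ∀ {t} → (R ⊎ G zero t) ⊎ ∃[ i ] (∀ t → G (suc i) t) → G zero t ⊎ Rest
  regroup (inj₁ (inj₁ r)) = inj₂ (inj₁ r)
  regroup (inj₁ (inj₂ g)) = inj₁ g
  regroup (inj₂ rest)     = inj₂ (inj₂ rest)

  fixedHead : ∀ t → G zero t ⊎ Rest
  fixedHead t = regroup (uniformFactor u (λ i → T (suc i)) (λ i → ex (suc i))
                  (λ i → G (suc i)) (R ⊎ G zero t) (λ q → shift (h (cons t q))))

unpair : ∀ {u} (e : Fin u → ℕ) → Fin (sumFin e) → Σ (Fin u) (λ i → Fin (e i))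
unpair {suc u} e k with splitAt (e zero) k
... | inj₁ j  = zero , j
... | inj₂ k′ with unpair (λ i → e (suc i)) k′
...   | i , j = suc i , j

pair : ∀ {u} (e : Fin u → ℕ) (i : Fin u) → Fin (e i) → Fin (sumFin e)
pair {suc u} e zero    j = j ↑ˡ sumFin (λ i → e (suc i))
pair {suc u} e (suc i) j = e zero ↑ʳ pair (λ i → e (suc i)) i j

unpair-pair : ∀ {u} (e : Fin u → ℕ) (i : Fin u) (j : Fin (e i)) →
              unpair e (pair e i j) ≡ (i , j)
unpair-pair {suc u} e zero j
  rewrite splitAt-↑ˡ (e zero) j (sumFin (λ i → e (suc i))) = refl
unpair-pair {suc u} e (suc i) j
  rewrite splitAt-↑ʳ (e zero) (sumFin (λ i → e (suc i))) (pair (λ i → e (suc i)) i j)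
        | unpair-pair (λ i → e (suc i)) i j = refl

isCover? : ∀ {n m} (I : Subset n) (P : Fin m → Subset n) → Dec (IsCover I P)
isCover? I P = all? (λ i → P i ⊆? I)
         ×-dec all? (λ j → (j ∈? I) →-dec any? (λ i → j ∈? P i))

cover-cong : ∀ {n m} {I : Subset n} {P Q : Fin m → Subset n} →
             (∀ i → P i ≡ Q i) → IsCover I P → IsCover I Q
cover-cong P≡Q (sub , cov) =
    (λ i x∈ → sub i (subst (_ ∈_) (sym (P≡Q i)) x∈))
  , (λ x x∈ → let (i , x∈P) = cov x x∈ in i , subst (x ∈_) (P≡Q i) x∈P)

concatenate : ∀ {n u} (e : Fin u → ℕ) → (∀ i → Vec (Subset n) (e i)) →
              Fin (sumFin e) → Subset n
concatenate e q k = lookup (q (proj₁ (unpair e k))) (proj₂ (unpair e k))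

concatenate-cover : ∀ {n u} {I : Subset n} {P : Fin u → Subset n}
                    (e : Fin u → ℕ) (q : ∀ i → Vec (Subset n) (e i)) →
                    IsCover I P → (∀ i → IsCover (P i) (lookup (q i))) →
                    IsCover I (concatenate e q)
concatenate-cover {I = I} e q (subP , covP) covq =
    (λ k x∈ → subP _ (proj₁ (covq _) _ x∈))
  , coverPoint
  where
  coverPoint : ∀ x → x ∈ I → ∃[ k ] (x ∈ concatenate e q k)
  coverPoint x x∈ with covP x x∈
  ... | i , x∈P with proj₂ (covq i) x x∈P
  ...   | j , x∈q = pair e i j
                  , subst (λ s → x ∈ lookup (q (proj₁ s)) (proj₂ s))
                          (sym (unpair-pair e i j)) x∈q

DispersityAt : ∀ {n m} → (Fin n → Clopen) → Subset n → Vec (Subset n) m → Set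
DispersityAt V I v = IsCover I (lookup v) → ∃[ j ] EmptyInter V (lookup v j)

disperse-fromVec : ∀ {n} (V : Fin n → Clopen) (I : Subset n) (m : ℕ) →
                   (∀ (v : Vec (Subset n) m) → DispersityAt V I v) →
                   Disperse V I m
disperse-fromVec V I m h Q cov
  with h (tabulate Q) (cover-cong (λ j → sym (lookup∘tabulate Q j)) cov)
... | j , empty = j , subst (EmptyInter V) (lookup∘tabulate Q j) empty

-- Every choice of candidate covers q i of the parts P i is refuted at some
-- index: either some q i fails to cover P i, or all do and Σ e-dispersity
-- of the concatenation yields a part with empty intersection.
everyChoiceRefuted : ∀ {n u} (e : Fin u → ℕ) (V : Fin n → Clopen)
                     {I : Subset n} → Disperse V I (sumFin e) →
                     (P : Fin u → Subset n) → IsCover I P →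
                     (q : ∀ i → Vec (Subset n) (e i)) →
                     ∃[ i ] DispersityAt V (P i) (q i)
everyChoiceRefuted {u = u} e V disp P cov q
  with all? (λ i → isCover? (P i) (lookup (q i)))
... | no notAll =
  let (i , notCover) = ¬∀⟶∃¬ u _ (λ i → isCover? (P i) (lookup (q i))) notAll
  in i , λ c → ⊥-elim (notCover c)
... | yes all with disp (concatenate e q) (concatenate-cover e q cov all)
...   | k , empty = proj₁ (unpair e k) , λ _ → proj₂ (unpair e k) , empty

fact4 : ∀ (u n : ℕ) (e : Fin u → ℕ) → (∀ i → 0 < e i) →
    (V : Fin n → Clopen) → Disperse V ⊤ (sumFin e) →
    Supporter n u (λ i K → Disperse V K (e i))
fact4 u n e _ V disp P cov
  with uniformFactor u (λ i → Vec (Subset n) (e i))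
         (λ i → exhaustible-Vec exhaustible-Subset (e i))
         (λ i → DispersityAt V (P i)) ⊥
         (λ q → inj₂ (everyChoiceRefuted e V disp P cov q))
... | inj₁ ()
... | inj₂ (i , uniform) =
  i , P i , disperse-fromVec V (P i) (e i) uniform , (λ x∈ → x∈)
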